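{- Let $n\ge1$ and $\mathbb{F}$ a field. The cosets of the monomials $m(\mathcal{R})=\prod_{(i,j)\in\mathcal{R}}x_{i,j}$, as $\mathcal{R}$ ranges over all rook placements $\mathcal{R}\subseteq[n]\times[n]$, span the quotient $\mathbb{F}[\mathbf{x}_{n\times n}]/I_n$ as an $\mathbb{F}$-vector space.
   Context: A rook placement is a subset of $[n]\times[n]$ with at most one point in each row and each column (the empty set is allowed, with $m(\varnothing)=1$). $\mathbb{F}[\mathbf{x}_{n\times n}]$ is the polynomial ring in variables $x_{i,j}$, $1\le i,j\le n$. $I_n$ is the ideal generated by all products $x_{i,j}x_{i,j'}$ and $x_{i,j}x_{i',j}$ (for all $1\le i,i',j,j'\le n$, including equal indices), all row sums $\sum_{j=1}^n x_{i,j}$ and all column sums $\sum_{i=1}^n x_{i,j}$. -}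

module Defs where

open import Level using (Level; _⊔_) renaming (suc to lsuc)
open import Algebra.Bundles using (CommutativeRing)
open import Data.Nat using (ℕ)
open import Data.Fin using (Fin)
open import Data.Product using (_×_; _,_; proj₁; proj₂; ∃)
open import Data.List using (List; []; _∷_; map; foldr)
import Data.List
open import Data.List.Relation.Unary.Unique.Propositional using (Unique)
open import Relation.Nullary using (¬_)

record Field (c ℓ : Level) : Set (lsuc (c ⊔ ℓ)) where
  field
    commutativeRing : CommutativeRing c ℓ
  open CommutativeRing commutativeRing public
  field
    0≉1     : ¬ (0# ≈ 1#)
    inverse : ∀ x → ¬ (x ≈ 0#) → ∃ λ y → (x * y) ≈ 1#

module _ {c ℓ : Level} (F : Field c ℓ) where
  private module F = Field F

  -- Polynomial expressions over F in the variables x_{i,j}, i,j ∈ [n]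
  -- (indices in Fin n, i.e. 0-based).

  data Poly (n : ℕ) : Set c where
    con  : F.Carrier → Poly n
    var  : Fin n → Fin n → Poly n
    _⊕_  : Poly n → Poly n → Poly n
    _⊗_  : Poly n → Poly n → Poly n

  infixl 6 _⊕_
  infixl 7 _⊗_

  module _ {n : ℕ} where
    zeroP oneP : Poly n
    zeroP = con F.0#
    oneP  = con F.1#

    negP : Poly n → Poly n
    negP p = con (F.- F.1#) ⊗ p

    sumP : List (Poly n) → Poly n
    sumP = foldr _⊕_ zeroP

    prodP : List (Poly n) → Poly n
    prodP = foldr _⊗_ oneP

  allFinL : (n : ℕ) → List (Fin n)
  allFinL n = Data.List.allFin n

  rowSum : (n : ℕ) → Fin n → Poly n
  rowSum n i = sumP (map (var i) (allFinL n))

  colSum : (n : ℕ) → Fin n → Poly n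
  colSum n j = sumP (map (λ i → var i j) (allFinL n))

  -- Congruence modulo I_n in F[x_{n×n}]:  p ≡I q  iff  p and q have the
  -- same image in F[x_{n×n}] / I_n.  The relation is the least congruence
  -- containing the commutative-ring axioms (so that Poly n modulo the
  -- ring axioms alone is the polynomial ring F[x_{n×n}]), making con a
  -- ring homomorphism from F, and identifying every generator of I_n
  -- with 0.

  infix 4 _≡I_

  data _≡I_ {n : ℕ} : Poly n → Poly n → Set (c ⊔ ℓ) where
    reflI  : ∀ {p} → p ≡I p
    symI   : ∀ {p q} → p ≡I q → q ≡I p
    transI : ∀ {p q r} → p ≡I q → q ≡I r → p ≡I r
    ⊕-cong : ∀ {p p′ q q′} → p ≡I p′ → q ≡I q′ → p ⊕ q ≡I p′ ⊕ q′
    ⊗-cong : ∀ {p p′ q q′} → p ≡I p′ → q ≡I q′ → p ⊗ q ≡I p′ ⊗ q′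
    ⊕-assoc : ∀ p q r → (p ⊕ q) ⊕ r ≡I p ⊕ (q ⊕ r)
    ⊕-comm  : ∀ p q → p ⊕ q ≡I q ⊕ p
    ⊕-idˡ   : ∀ p → zeroP ⊕ p ≡I p
    ⊕-invˡ  : ∀ p → negP p ⊕ p ≡I zeroP
    ⊗-assoc : ∀ p q r → (p ⊗ q) ⊗ r ≡I p ⊗ (q ⊗ r)
    ⊗-comm  : ∀ p q → p ⊗ q ≡I q ⊗ p
    ⊗-idˡ   : ∀ p → oneP ⊗ p ≡I p
    distribˡ : ∀ p q r → p ⊗ (q ⊕ r) ≡I (p ⊗ q) ⊕ (p ⊗ r)
    con-cong : ∀ {a b} → a F.≈ b → con a ≡I con b
    con-+    : ∀ a b → con a ⊕ con b ≡I con (a F.+ b)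
    con-*    : ∀ a b → con a ⊗ con b ≡I con (a F.* b)
    gen-row : ∀ i j j′ → var i j ⊗ var i j′ ≡I zeroP
    gen-col : ∀ i i′ j → var i j ⊗ var i′ j ≡I zeroP
    gen-rowSum : ∀ i → rowSum n i ≡I zeroP
    gen-colSum : ∀ j → colSum n j ≡I zeroP

  -- Rook placements: a finite set of cells of [n]×[n] (a list of cells)
  -- with at most one cell in each row and each column, i.e. the row
  -- indices are pairwise distinct and the column indices are pairwise
  -- distinct (this also forces the cells to be distinct).

  record RookPlacement (n : ℕ) : Set where
    constructor rook
    field
      cells      : List (Fin n × Fin n)
      rowsUnique : Unique (map proj₁ cells)
      colsUnique : Unique (map proj₂ cells)

  monomial : ∀ {n} → RookPlacement n → Poly n
  monomial R = prodP (map (λ ij → var (proj₁ ij) (proj₂ ij)) (RookPlacement.cells R))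

  rookCombination : ∀ {n} → List (F.Carrier × RookPlacement n) → Poly n
  rookCombination cs = sumP (map (λ cR → con (proj₁ cR) ⊗ monomial (proj₂ cR)) cs)

{-# OPTIONS --safe #-}
-- Expanding products, every polynomial is a linear combination of monomials
-- x_{c₁} ⋯ x_{c_k} in cells c₁ … c_k. If two of these cells share a row or
-- a column, the monomial contains one of the quadratic generators of I_n as a
-- factor and vanishes; otherwise the cells form a rook placement.
module Submission where

open import Defs
open import Level using (Level; _⊔_)
open import Data.Nat using (ℕ; _≥_)
open import Data.Fin using (Fin; _≟_)
open import Data.Product using (_×_; ∃; _,_; proj₁; proj₂)
open import Data.Sum using (_⊎_; inj₁; inj₂)
open import Data.List using (List; []; _∷_; _++_; map)
open import Data.List.Membership.Propositional using (_∈_; find)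
open import Data.List.Relation.Unary.Any using (here; there; any?)
open import Data.List.Relation.Unary.AllPairs using ([]; _∷_)
open import Data.List.Relation.Unary.All.Properties using (¬Any⇒All¬; map⁺)
open import Relation.Binary.Bundles using (Setoid)
open import Relation.Binary.PropositionalEquality using (_≡_; refl)
import Relation.Binary.Reasoning.Setoid as SetoidReasoning
open import Relation.Nullary using (yes; no)

module _ {c ℓ : Level} (F : Field c ℓ) (n : ℕ) where
  private module F = Field F

  ≡I-setoid : Setoid c (c ⊔ ℓ)
  ≡I-setoid = record
    { Carrier = Poly F n
    ; _≈_ = _≡I_ F
    ; isEquivalence = record { refl = reflI ; sym = symI ; trans = transI }
    }

  open Setoid ≡I-setoid using (_≈_)
  open SetoidReasoning ≡I-setoid

  ⊕-idʳ : ∀ p → p ⊕ zeroP F ≈ p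
  ⊕-idʳ p = transI (⊕-comm p _) (⊕-idˡ p)

  distribʳ : ∀ p q r → (q ⊕ r) ⊗ p ≈ (q ⊗ p) ⊕ (r ⊗ p)
  distribʳ p q r = begin
    (q ⊕ r) ⊗ p        ≈⟨ ⊗-comm _ _ ⟩
    p ⊗ (q ⊕ r)        ≈⟨ distribˡ p q r ⟩
    p ⊗ q ⊕ p ⊗ r      ≈⟨ ⊕-cong (⊗-comm p q) (⊗-comm p r) ⟩
    q ⊗ p ⊕ r ⊗ p      ∎

  x≈x⊕x⇒x≈0 : ∀ x → x ≈ x ⊕ x → x ≈ zeroP F
  x≈x⊕x⇒x≈0 x x≈x⊕x = begin
    x                        ≈⟨ ⊕-idˡ x ⟨
    zeroP F ⊕ x              ≈⟨ ⊕-cong (⊕-invˡ x) reflI ⟨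
    (negP F x ⊕ x) ⊕ x       ≈⟨ ⊕-assoc _ _ _ ⟩
    negP F x ⊕ (x ⊕ x)       ≈⟨ ⊕-cong reflI x≈x⊕x ⟨
    negP F x ⊕ x             ≈⟨ ⊕-invˡ x ⟩
    zeroP F                  ∎

  zeroˡ : ∀ p → zeroP F ⊗ p ≈ zeroP F
  zeroˡ p = x≈x⊕x⇒x≈0 _ (transI (⊗-cong (symI (⊕-idˡ _)) reflI) (distribʳ p _ _))

  zeroʳ : ∀ p → p ⊗ zeroP F ≈ zeroP F
  zeroʳ p = transI (⊗-comm _ _) (zeroˡ p)

  x⊗yz≈y⊗xz : ∀ x y z → x ⊗ (y ⊗ z) ≈ y ⊗ (x ⊗ z)
  x⊗yz≈y⊗xz x y z = begin
    x ⊗ (y ⊗ z)   ≈⟨ ⊗-assoc _ _ _ ⟨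
    (x ⊗ y) ⊗ z   ≈⟨ ⊗-cong (⊗-comm x y) reflI ⟩
    (y ⊗ x) ⊗ z   ≈⟨ ⊗-assoc _ _ _ ⟩
    y ⊗ (x ⊗ z)   ∎

  Cell : Set
  Cell = Fin n × Fin n

  cellVar : Cell → Poly F n
  cellVar (i , j) = var i j

  cellMonomial : List Cell → Poly F n
  cellMonomial cs = prodP F (map cellVar cs)

  cellMonomial-++ : ∀ cs ds → cellMonomial (cs ++ ds) ≈ cellMonomial cs ⊗ cellMonomial ds
  cellMonomial-++ []       ds = symI (⊗-idˡ _)
  cellMonomial-++ (c ∷ cs) ds = transI (⊗-cong reflI (cellMonomial-++ cs ds)) (symI (⊗-assoc _ _ _))

  cellMonomial-factor : ∀ {d cs} → d ∈ cs → ∃ λ X → cellMonomial cs ≈ cellVar d ⊗ X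
  cellMonomial-factor {cs = _ ∷ cs} (here refl) = cellMonomial cs , reflI
  cellMonomial-factor {cs = c ∷ _}  (there d∈cs) =
    let X , eq = cellMonomial-factor d∈cs
    in cellVar c ⊗ X , transI (⊗-cong reflI eq) (x⊗yz≈y⊗xz _ _ _)

  cellMonomial-annihilated : ∀ {c d} cs → cellVar c ⊗ cellVar d ≈ zeroP F →
                             d ∈ cs → cellMonomial (c ∷ cs) ≈ zeroP F
  cellMonomial-annihilated {c} {d} cs cd≈0 d∈cs = begin
    cellVar c ⊗ cellMonomial cs       ≈⟨ ⊗-cong reflI eq ⟩
    cellVar c ⊗ (cellVar d ⊗ X)       ≈⟨ ⊗-assoc _ _ _ ⟨
    (cellVar c ⊗ cellVar d) ⊗ X       ≈⟨ ⊗-cong cd≈0 reflI ⟩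
    zeroP F ⊗ X                       ≈⟨ zeroˡ X ⟩
    zeroP F                           ∎
    where
    X = proj₁ (cellMonomial-factor d∈cs)
    eq = proj₂ (cellMonomial-factor d∈cs)

  cellMonomial-zero-or-rook : ∀ cs → cellMonomial cs ≈ zeroP F
                            ⊎ ∃ λ (R : RookPlacement F n) → RookPlacement.cells R ≡ cs
  cellMonomial-zero-or-rook [] = inj₂ (rook [] [] [] , refl)
  cellMonomial-zero-or-rook ((i , j) ∷ cs)
    with any? (λ d → i ≟ proj₁ d) cs | any? (λ d → j ≟ proj₂ d) cs
       | cellMonomial-zero-or-rook cs
  ... | yes sameRow | _ | _ with find sameRow
  ...   | (.i , j′) , d∈cs , refl = inj₁ (cellMonomial-annihilated cs (gen-row i j j′) d∈cs)
  cellMonomial-zero-or-rook ((i , j) ∷ cs)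
      | no _ | yes sameCol | _ with find sameCol
  ...   | (i′ , .j) , d∈cs , refl = inj₁ (cellMonomial-annihilated cs (gen-col i i′ j) d∈cs)
  cellMonomial-zero-or-rook ((i , j) ∷ cs)
      | no _ | no _ | inj₁ cs≈0 = inj₁ (transI (⊗-cong reflI cs≈0) (zeroʳ _))
  cellMonomial-zero-or-rook ((i , j) ∷ cs)
      | no newRow | no newCol | inj₂ (rook .cs rowsU colsU , refl) =
    inj₂ (rook ((i , j) ∷ cs) (map⁺ (¬Any⇒All¬ cs newRow) ∷ rowsU)
                              (map⁺ (¬Any⇒All¬ cs newCol) ∷ colsU) , refl)

  Term : Set c
  Term = F.Carrier × List Cell

  Expansion : Set c
  Expansion = List Term

  ⟦_⟧ᵗ : Term → Poly F n
  ⟦ a , cs ⟧ᵗ = con a ⊗ cellMonomial cs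

  ⟦_⟧ : Expansion → Poly F n
  ⟦ ts ⟧ = sumP F (map ⟦_⟧ᵗ ts)

  ⟦⟧-++ : ∀ ts us → ⟦ ts ++ us ⟧ ≈ ⟦ ts ⟧ ⊕ ⟦ us ⟧
  ⟦⟧-++ []       us = symI (⊕-idˡ _)
  ⟦⟧-++ (t ∷ ts) us = transI (⊕-cong reflI (⟦⟧-++ ts us)) (symI (⊕-assoc _ _ _))

  _·ᵗ_ : Term → Term → Term
  (a , cs) ·ᵗ (b , ds) = a F.* b , cs ++ ds

  ⟦⟧ᵗ-· : ∀ t u → ⟦ t ⟧ᵗ ⊗ ⟦ u ⟧ᵗ ≈ ⟦ t ·ᵗ u ⟧ᵗ
  ⟦⟧ᵗ-· (a , cs) (b , ds) = begin
    (con a ⊗ cellMonomial cs) ⊗ (con b ⊗ cellMonomial ds)  ≈⟨ ⊗-assoc _ _ _ ⟩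
    con a ⊗ (cellMonomial cs ⊗ (con b ⊗ cellMonomial ds))  ≈⟨ ⊗-cong reflI (x⊗yz≈y⊗xz _ _ _) ⟩
    con a ⊗ (con b ⊗ (cellMonomial cs ⊗ cellMonomial ds))  ≈⟨ ⊗-assoc _ _ _ ⟨
    (con a ⊗ con b) ⊗ (cellMonomial cs ⊗ cellMonomial ds)  ≈⟨ ⊗-cong (con-* a b) (symI (cellMonomial-++ cs ds)) ⟩
    con (a F.* b) ⊗ cellMonomial (cs ++ ds)                 ∎

  _·_ : Expansion → Expansion → Expansion
  []       · us = []
  (t ∷ ts) · us = map (t ·ᵗ_) us ++ ts · us

  ⟦⟧ᵗ-·-distrib : ∀ t us → ⟦ t ⟧ᵗ ⊗ ⟦ us ⟧ ≈ ⟦ map (t ·ᵗ_) us ⟧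
  ⟦⟧ᵗ-·-distrib t []       = zeroʳ _
  ⟦⟧ᵗ-·-distrib t (u ∷ us) =
    transI (distribˡ _ _ _) (⊕-cong (⟦⟧ᵗ-· t u) (⟦⟧ᵗ-·-distrib t us))

  ⟦⟧-· : ∀ ts us → ⟦ ts ⟧ ⊗ ⟦ us ⟧ ≈ ⟦ ts · us ⟧
  ⟦⟧-· []       us = zeroˡ _
  ⟦⟧-· (t ∷ ts) us = begin
    (⟦ t ⟧ᵗ ⊕ ⟦ ts ⟧) ⊗ ⟦ us ⟧                ≈⟨ distribʳ _ _ _ ⟩
    ⟦ t ⟧ᵗ ⊗ ⟦ us ⟧ ⊕ ⟦ ts ⟧ ⊗ ⟦ us ⟧         ≈⟨ ⊕-cong (⟦⟧ᵗ-·-distrib t us) (⟦⟧-· ts us) ⟩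
    ⟦ map (t ·ᵗ_) us ⟧ ⊕ ⟦ ts · us ⟧          ≈⟨ ⟦⟧-++ (map (t ·ᵗ_) us) (ts · us) ⟨
    ⟦ map (t ·ᵗ_) us ++ ts · us ⟧             ∎

  expand : ∀ f → ∃ λ ts → f ≈ ⟦ ts ⟧
  expand (con a) = (a , []) ∷ [] , symI (transI (⊕-idʳ _) (transI (⊗-comm _ _) (⊗-idˡ _)))
  expand (var i j) = (F.1# , (i , j) ∷ []) ∷ [] ,
    symI (transI (⊕-idʳ _) (transI (⊗-idˡ _) (transI (⊗-comm _ _) (⊗-idˡ _))))
  expand (f ⊕ g) =
    let ts , f≈ts = expand f ; us , g≈us = expand g
    in ts ++ us , transI (⊕-cong f≈ts g≈us) (symI (⟦⟧-++ ts us))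
  expand (f ⊗ g) =
    let ts , f≈ts = expand f ; us , g≈us = expand g
    in ts · us , transI (⊗-cong f≈ts g≈us) (⟦⟧-· ts us)

  expansion-rookCombination : ∀ ts → ∃ λ cs → ⟦ ts ⟧ ≈ rookCombination F cs
  expansion-rookCombination [] = [] , reflI
  expansion-rookCombination ((a , ds) ∷ ts)
    with expansion-rookCombination ts | cellMonomial-zero-or-rook ds
  ... | cs , ts≈cs | inj₁ ds≈0 =
    cs , transI (⊕-cong (transI (⊗-cong reflI ds≈0) (zeroʳ _)) ts≈cs) (⊕-idˡ _)
  ... | cs , ts≈cs | inj₂ (R , refl) = (a , R) ∷ cs , ⊕-cong reflI ts≈cs

-- Spanning needs only the quadratic generators of I_n.
lemma3p7 : ∀ {c ℓ : Level} (F : Field c ℓ) (n : ℕ) → n ≥ 1 →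
    ∀ (f : Poly F n) →
      ∃ λ (cs : List (Field.Carrier F × RookPlacement F n)) →
        _≡I_ F f (rookCombination F cs)
lemma3p7 F n _ f =
  let ts , f≈ts  = expand F n f
      cs , ts≈cs = expansion-rookCombination F n ts
  in cs , transI f≈ts ts≈cs
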